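{- Let $D$ be a (finite) digraph. Then $D$ has a strong in-domatic partition if and only if $D$ is strong.
   Context: All digraphs are finite, loopless, without parallel arcs. A digraph is strong if for every pair of vertices $u,v$ there is a directed $uv$-walk and a directed $vu$-walk (a one-vertex digraph is strong). For $S\subseteq V(D)$, $D\langle S\rangle$ is the subdigraph induced by $S$. A set $S\subseteq V(D)$ is in-dominating if every vertex $x\in V(D)\setminus S$ has an out-neighbor in $S$, i.e. there is $z\in S$ with $(x,z)\in A(D)$. $S$ is a strong in-dominating set if it is in-dominating and $D\langle S\rangle$ is strong. A strong in-domatic partition of $D$ is a partition of $V(D)$ into strong in-dominating sets. -}

module Defs where

open import Data.Nat using (ℕ)
open import Data.Fin using (Fin)
open import Data.Bool using (Bool; false; T)
open import Data.Product using (Σ; ∃; _×_; _,_)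
open import Relation.Binary.PropositionalEquality using (_≡_)
open import Relation.Binary.Construct.Closure.ReflexiveTransitive using (Star)
open import Relation.Unary using (Pred; _∈_; _∉_)
open import Level using (0ℓ)

-- A finite digraph: vertex set Fin n, arcs given by a Boolean adjacency
-- relation (so no parallel arcs), with no loops.
record Digraph : Set where
  field
    n        : ℕ
    arc      : Fin n → Fin n → Bool
    loopless : ∀ x → arc x x ≡ false

open Digraph public

Vertex : Digraph → Set
Vertex D = Fin (n D)

Arc : (D : Digraph) → Vertex D → Vertex D → Set
Arc D x y = T (arc D x y)

VSet : Digraph → Set₁
VSet D = Pred (Vertex D) 0ℓ

ArcIn : (D : Digraph) → VSet D → Vertex D → Vertex D → Set
ArcIn D S x y = x ∈ S × y ∈ S × Arc D x y

InducedStrong : (D : Digraph) → VSet D → Set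
InducedStrong D S = ∀ u v → u ∈ S → v ∈ S → Star (ArcIn D S) u v

IsStrong : Digraph → Set
IsStrong D = ∀ (u v : Vertex D) → Star (Arc D) u v

InDominating : (D : Digraph) → VSet D → Set
InDominating D S = ∀ x → x ∉ S → Σ (Vertex D) λ z → z ∈ S × Arc D x z

StrongInDominating : (D : Digraph) → VSet D → Set
StrongInDominating D S = InDominating D S × InducedStrong D S

-- A strong in-domatic partition: a partition of V(D) into k nonempty parts,
-- encoded by the part-assignment map c : V(D) → Fin k (the parts are the
-- fibres c⁻¹(i)), each part being a strong in-dominating set.
record StrongInDomaticPartition (D : Digraph) : Set where
  field
    k          : ℕ
    part       : Vertex D → Fin k
    nonempty   : ∀ (i : Fin k) → ∃ λ x → part x ≡ i
    strongInDom : ∀ (i : Fin k) → StrongInDominating D (λ x → part x ≡ i)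

-- A vertex u outside the part S of v has an out-arc into S, and D⟨S⟩ is
-- strong, so u reaches v; hence any strong in-domatic partition makes D
-- strong. Conversely, if D is strong then V(D) itself is a strong
-- in-dominating set (vacuously dominating), giving a one-part partition
-- (or the empty partition of the empty digraph).
module Submission where

open import Defs
open import Data.Empty using (⊥-elim)
open import Data.Fin using (Fin; zero; _≟_)
open import Data.Nat using (ℕ; zero; suc)
open import Data.Product using (_,_; proj₂)
open import Function.Bundles using (_⇔_; mk⇔)
open import Relation.Binary.Construct.Closure.ReflexiveTransitive using (Star; _◅_)
import Relation.Binary.Construct.Closure.ReflexiveTransitive as Star
open import Relation.Binary.PropositionalEquality using (_≡_; refl)
open import Relation.Nullary using (Dec; yes; no; ¬_)
open import Relation.Unary using (Decidable; _∈_)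

module _ {D : Digraph} {S : VSet D} where

  induced-walk⇒walk : ∀ {u v} → Star (ArcIn D S) u v → Star (Arc D) u v
  induced-walk⇒walk = Star.map (λ (_ , _ , a) → a)

  walk⇒induced-walk : (∀ x → x ∈ S) → ∀ {u v} → Star (Arc D) u v → Star (ArcIn D S) u v
  walk⇒induced-walk full = Star.map (λ {x} {y} a → full x , full y , a)

  strongInDominating⇒reaches : Decidable S → StrongInDominating D S →
                               ∀ {v} → v ∈ S → ∀ u → Star (Arc D) u v
  strongInDominating⇒reaches S? (dom , strong) {v} v∈S u with S? u
  ... | yes u∈S = induced-walk⇒walk (strong u v u∈S v∈S)
  ... | no  u∉S with dom u u∉S
  ...   | z , z∈S , u→z = u→z ◅ induced-walk⇒walk (strong z v z∈S v∈S)

  strong⇒full-strongInDominating : IsStrong D → (∀ x → x ∈ S) → StrongInDominating D S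
  strong⇒full-strongInDominating strong full =
      (λ x x∉S → ⊥-elim (x∉S (full x)))
    , (λ u v _ _ → walk⇒induced-walk full (strong u v))

partition⇒strong : (D : Digraph) → StrongInDomaticPartition D → IsStrong D
partition⇒strong D P u v =
  strongInDominating⇒reaches {D = D} {S = λ x → part x ≡ part v}
    (λ x → part x ≟ part v) (strongInDom (part v)) refl u
  where open StrongInDomaticPartition P

fin? : (m : ℕ) → Dec (Fin m)
fin? zero    = no λ ()
fin? (suc m) = yes zero

module _ (D : Digraph) where

  singlePartition : IsStrong D → Vertex D → StrongInDomaticPartition D
  singlePartition strong v = record
    { k           = 1
    ; part        = λ _ → zero
    ; nonempty    = λ { zero → v , refl }
    ; strongInDom = λ { zero → strong⇒full-strongInDominating {D = D} {S = λ _ → zero ≡ zero} strong (λ _ → refl) }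
    }

  emptyPartition : ¬ Vertex D → StrongInDomaticPartition D
  emptyPartition noVertex = record
    { k           = 0
    ; part        = λ x → ⊥-elim (noVertex x)
    ; nonempty    = λ ()
    ; strongInDom = λ ()
    }

  strong⇒partition : IsStrong D → StrongInDomaticPartition D
  strong⇒partition strong with fin? (n D)
  ... | yes v      = singlePartition strong v
  ... | no  absurd = emptyPartition absurd

theorem3 : (D : Digraph) → StrongInDomaticPartition D ⇔ IsStrong D
theorem3 D = mk⇔ (partition⇒strong D) (strong⇒partition D)
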